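{- Let $n\ge1$ and let $T:S_n\to S_n$ be defined by $T(w)=w\cdot t_{1,w(1)}$, where $t_{1,k}$ denotes the transposition of $1$ and $k$ (the identity if $k=1$). Then for each $w\in S_n$ we have $T^{n-1}(w)(1)=1$, and moreover $\operatorname{tn} T=n-1$.
   Context: $[n]=\{1,\dots,n\}$, $S_n$ is the group of bijections $[n]\to[n]$ with product $(ab)(i)=a(b(i))$. $T^m$ is the $m$-th iterate of $T$. For a map $F:S_n\to S_n$, the termination number $\operatorname{tn}F$ is the smallest $m\in\mathbb{N}$ such that $F^m(w)(1)=1$ for all $w\in S_n$. -}

module Defs where

open import Data.Nat using (ℕ; zero; suc; _≤_)
open import Data.Fin using (Fin; zero)
open import Data.Fin.Permutation using (Permutation′; _⟨$⟩ʳ_; _∘ₚ_; transpose)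
open import Data.Product using (_×_)
open import Relation.Binary.PropositionalEquality using (_≡_)

-- Elements of [n] are represented by Fin n; the element 1 of [n] is 'zero'.
-- S_n is Permutation′ n; w(i) is  w ⟨$⟩ʳ i .

iter : {A : Set} → (A → A) → ℕ → A → A
iter F zero    x = x
iter F (suc m) x = F (iter F m x)

-- the map T(w) = w · t_{1,w(1)}, with (ab)(i) = a(b(i)).
-- (p ∘ₚ q applies p first, then q; so  t ∘ₚ w  is  i ↦ w (t i)  = w·t.)
-- transpose i i is the identity permutation.
T : {n : ℕ} → Permutation′ (suc n) → Permutation′ (suc n)
T w = transpose zero (w ⟨$⟩ʳ zero) ∘ₚ w

Terminates : {n : ℕ} → (Permutation′ (suc n) → Permutation′ (suc n)) → ℕ → Set
Terminates F m = ∀ w → iter F m w ⟨$⟩ʳ zero ≡ zero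

IsTerminationNumber : {n : ℕ} → (Permutation′ (suc n) → Permutation′ (suc n)) → ℕ → Set
IsTerminationNumber F m = Terminates F m × (∀ m′ → Terminates F m′ → m ≤ m′)

-- Upper bound: while w(1) ≠ 1, say w(1) = a, the map T fixes every point
-- i ≠ 1 that w fixes and additionally fixes a, which w moves.  So after m
-- steps without reaching w(1) = 1 there are at least m fixed points among
-- the n - 1 points ≠ 1, and not all of them are fixed; hence m < n - 1.
-- Lower bound: T maps the cycle (1 j j-1 … 2) to the cycle (1 j-1 … 2), so
-- the cycle (1 n n-1 … 2) needs n - 1 steps to fix 1.
module Submission where

open import Defs
open import Data.Nat using (ℕ; zero; suc; _≤_; _<_; z≤n; s≤s)
open import Data.Nat.Properties
  using (<-trans; <-≤-trans; ≤-<-trans; ≤-refl; ≤-reflexive; <⇒≤; <-irrefl; ≮⇒≥; n<1+n)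
open import Data.Fin using (Fin; zero; suc; toℕ; fromℕ<)
open import Data.Fin.Properties using (_≟_; toℕ-fromℕ<)
open import Data.Fin.Permutation using (Permutation′; _⟨$⟩ʳ_; _∘ₚ_; _≈_; transpose; id)
import Data.Fin.Permutation.Components as PC
open import Data.Fin.Subset using (Subset; _∈_; _⊆_; _⊂_; ⊤; ∣_∣)
open import Data.Fin.Subset.Properties using (∈⊤; p⊂q⇒∣p∣<∣q∣; ∣⊤∣≡n)
open import Data.Vec using (tabulate)
open import Data.Vec.Properties using (lookup∘tabulate; []=⇒lookup; lookup⇒[]=)
open import Data.Product using (_×_; _,_; ∃-syntax)
open import Data.Empty using (⊥-elim)
open import Function.Bundles using (Injection)
open import Function.Properties.Inverse using (Inverse⇒Injection)
open import Relation.Nullary using (Dec; yes; no; does; contradiction)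
open import Relation.Nullary.Decidable using (dec-true; dec-false)
open import Relation.Unary using (Pred; Decidable)
open import Relation.Binary.PropositionalEquality using (_≡_; _≢_; refl; sym; trans; cong)
open import Level using (Level)

private
  variable
    ℓ : Level
    n : ℕ

iter-suc : {A : Set} (F : A → A) (m : ℕ) (x : A) → iter F (suc m) x ≡ iter F m (F x)
iter-suc F zero    x = refl
iter-suc F (suc m) x = cong F (iter-suc F m x)

decSubset : {P : Pred (Fin n) ℓ} → Decidable P → Subset n
decSubset P? = tabulate (λ i → does (P? i))

module _ {P : Pred (Fin n) ℓ} (P? : Decidable P) where

  ∈-decSubset⁺ : ∀ {i} → P i → i ∈ decSubset P?
  ∈-decSubset⁺ {i} p = lookup⇒[]= i _ (trans (lookup∘tabulate _ i) (dec-true (P? i) p))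

  ∈-decSubset⁻ : ∀ {i} → i ∈ decSubset P? → P i
  ∈-decSubset⁻ {i} i∈ with P? i | trans (sym (lookup∘tabulate _ i)) ([]=⇒lookup i∈)
  ... | yes p | _ = p
  ... | no  _ | ()

≢zero⇒suc : {i : Fin (suc n)} → i ≢ zero → ∃[ j ] i ≡ suc j
≢zero⇒suc {i = zero}  i≢0 = contradiction refl i≢0
≢zero⇒suc {i = suc j} _   = j , refl

module _ (i j : Fin n) where

  transpose-matchˡ : PC.transpose i j i ≡ j
  transpose-matchˡ rewrite dec-true (i ≟ i) refl = refl

  transpose-matchʳ : PC.transpose i j j ≡ i
  transpose-matchʳ with j ≟ i
  ... | yes j≡i = j≡i
  ... | no  _   rewrite dec-true (j ≟ j) refl = refl

  transpose-mismatch : ∀ {k} → k ≢ i → k ≢ j → PC.transpose i j k ≡ k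
  transpose-mismatch {k} k≢i k≢j rewrite dec-false (k ≟ i) k≢i | dec-false (k ≟ j) k≢j = refl

  transpose-involutive : ∀ k → PC.transpose i j (PC.transpose i j k) ≡ k
  transpose-involutive k = by-cases (k ≟ i) (k ≟ j)
    where
    by-cases : Dec (k ≡ i) → Dec (k ≡ j) → PC.transpose i j (PC.transpose i j k) ≡ k
    by-cases (yes refl) _          = trans (cong (PC.transpose i j) transpose-matchˡ) transpose-matchʳ
    by-cases (no  _)    (yes refl) = trans (cong (PC.transpose i j) transpose-matchʳ) transpose-matchˡ
    by-cases (no  k≢i)  (no  k≢j)  =
      trans (cong (PC.transpose i j) (transpose-mismatch k≢i k≢j)) (transpose-mismatch k≢i k≢j)

permutation-injective : (u : Permutation′ n) {i j : Fin n} → u ⟨$⟩ʳ i ≡ u ⟨$⟩ʳ j → i ≡ j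
permutation-injective u = Injection.injective (Inverse⇒Injection u)

T-cong : {u v : Permutation′ (suc n)} → u ≈ v → T u ≈ T v
T-cong u≈v i rewrite u≈v zero = u≈v _

iter-T-cong : (m : ℕ) {u v : Permutation′ (suc n)} → u ≈ v → iter T m u ≈ iter T m v
iter-T-cong zero    u≈v = u≈v
iter-T-cong (suc m) {u} {v} u≈v = T-cong {u = iter T m u} {v = iter T m v} (iter-T-cong m u≈v)

T-fixes-zero : (u : Permutation′ (suc n)) → u ⟨$⟩ʳ zero ≡ zero → T u ⟨$⟩ʳ zero ≡ zero
T-fixes-zero u u0≡0 = trans (cong (u ⟨$⟩ʳ_) (trans (transpose-matchˡ zero _) u0≡0)) u0≡0

-- The fixed points of u other than zero (the point 1); i ∈ fixedPoints u stands for suc i.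
fixedPoints : Permutation′ (suc n) → Subset n
fixedPoints u = decSubset (λ i → u ⟨$⟩ʳ suc i ≟ suc i)

∈-fixedPoints⁺ : (u : Permutation′ (suc n)) {i : Fin n} → u ⟨$⟩ʳ suc i ≡ suc i → i ∈ fixedPoints u
∈-fixedPoints⁺ u = ∈-decSubset⁺ (λ i → u ⟨$⟩ʳ suc i ≟ suc i)

∈-fixedPoints⁻ : (u : Permutation′ (suc n)) {i : Fin n} → i ∈ fixedPoints u → u ⟨$⟩ʳ suc i ≡ suc i
∈-fixedPoints⁻ u = ∈-decSubset⁻ (λ i → u ⟨$⟩ʳ suc i ≟ suc i)

module _ (u : Permutation′ (suc n)) {a : Fin n} (u0≡a : u ⟨$⟩ʳ zero ≡ suc a) where

  private
    moves-a : u ⟨$⟩ʳ suc a ≢ suc a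
    moves-a ua≡a with permutation-injective u (trans ua≡a (sym u0≡a))
    ... | ()

  fixedPoints-⊂-⊤ : fixedPoints u ⊂ ⊤
  fixedPoints-⊂-⊤ = (λ _ → ∈⊤) , a , ∈⊤ , λ a∈ → moves-a (∈-fixedPoints⁻ u a∈)

  fixedPoints-⊂-T : fixedPoints u ⊂ fixedPoints (T u)
  fixedPoints-⊂-T = ⊆-T , a , ∈-fixedPoints⁺ (T u) T-fixes-a , λ a∈ → moves-a (∈-fixedPoints⁻ u a∈)
    where
    T-fixes-a : T u ⟨$⟩ʳ suc a ≡ suc a
    T-fixes-a = trans (cong (u ⟨$⟩ʳ_) (trans (cong (λ x → PC.transpose zero x (suc a)) u0≡a)
                                             (transpose-matchʳ zero (suc a)))) u0≡a

    -- T u agrees with u off {zero, u zero}, and no fixed point of u is u zero.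
    ⊆-T : fixedPoints u ⊆ fixedPoints (T u)
    ⊆-T {i} i∈ =
      ∈-fixedPoints⁺ (T u) (trans (cong (u ⟨$⟩ʳ_) (transpose-mismatch zero _ (λ ()) i≢u0)) ui≡i)
      where
      ui≡i : u ⟨$⟩ʳ suc i ≡ suc i
      ui≡i = ∈-fixedPoints⁻ u i∈
      i≢u0 : suc i ≢ u ⟨$⟩ʳ zero
      i≢u0 i≡u0 with permutation-injective u (trans ui≡i i≡u0)
      ... | ()

moves-zero⇒∣fixedPoints∣<n : (u : Permutation′ (suc n)) → u ⟨$⟩ʳ zero ≢ zero → ∣ fixedPoints u ∣ < n
moves-zero⇒∣fixedPoints∣<n {n} u u0≢0 with a , eq ← ≢zero⇒suc u0≢0 =
  <-≤-trans (p⊂q⇒∣p∣<∣q∣ (fixedPoints-⊂-⊤ u eq)) (≤-reflexive (∣⊤∣≡n n))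

moves-zero⇒∣fixedPoints∣<∣fixedPoints-T∣ : (u : Permutation′ (suc n)) → u ⟨$⟩ʳ zero ≢ zero →
  ∣ fixedPoints u ∣ < ∣ fixedPoints (T u) ∣
moves-zero⇒∣fixedPoints∣<∣fixedPoints-T∣ u u0≢0 with a , eq ← ≢zero⇒suc u0≢0 =
  p⊂q⇒∣p∣<∣q∣ (fixedPoints-⊂-T u eq)

moves-zero⇒steps≤∣fixedPoints∣ : (m : ℕ) (w : Permutation′ (suc n)) →
  iter T m w ⟨$⟩ʳ zero ≢ zero → m ≤ ∣ fixedPoints (iter T m w) ∣
moves-zero⇒steps≤∣fixedPoints∣ zero    w _     = z≤n
moves-zero⇒steps≤∣fixedPoints∣ (suc m) w moves =
  ≤-<-trans (moves-zero⇒steps≤∣fixedPoints∣ m w previous-moves)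
            (moves-zero⇒∣fixedPoints∣<∣fixedPoints-T∣ (iter T m w) previous-moves)
  where
  previous-moves : iter T m w ⟨$⟩ʳ zero ≢ zero
  previous-moves fixes = moves (T-fixes-zero (iter T m w) fixes)

iter-T-fixes-zero : (w : Permutation′ (suc n)) → iter T n w ⟨$⟩ʳ zero ≡ zero
iter-T-fixes-zero {n} w with iter T n w ⟨$⟩ʳ zero ≟ zero
... | yes fixes = fixes
... | no  moves = ⊥-elim (<-irrefl refl
  (≤-<-trans (moves-zero⇒steps≤∣fixedPoints∣ n w moves)
             (moves-zero⇒∣fixedPoints∣<n (iter T n w) moves)))

-- descendingCycle j is the cycle 0 ↦ j ↦ j-1 ↦ … ↦ 1 ↦ 0 of Fin (suc n).
descendingCycle : (j : ℕ) → .(j ≤ n) → Permutation′ (suc n)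
descendingCycle zero    _   = id
descendingCycle (suc j) j<n = transpose zero (fromℕ< (s≤s j<n)) ∘ₚ descendingCycle j (<⇒≤ j<n)

descendingCycle-fixes-above : (j : ℕ) .(j≤n : j ≤ n) (i : Fin (suc n)) → j < toℕ i →
  descendingCycle j j≤n ⟨$⟩ʳ i ≡ i
descendingCycle-fixes-above zero    _   i       _   = refl
descendingCycle-fixes-above (suc j) j<n (suc i) j<i =
  trans (cong (descendingCycle j (<⇒≤ j<n) ⟨$⟩ʳ_) (transpose-mismatch zero _ (λ ()) i≢j))
        (descendingCycle-fixes-above j (<⇒≤ j<n) (suc i) (<-trans (n<1+n j) j<i))
  where
  i≢j : suc i ≢ fromℕ< (s≤s j<n)
  i≢j i≡j = <-irrefl (sym (trans (cong toℕ i≡j) (toℕ-fromℕ< (s≤s j<n)))) j<i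

descendingCycle-zero : (j : ℕ) .(j≤n : j ≤ n) → descendingCycle j j≤n ⟨$⟩ʳ zero ≡ fromℕ< (s≤s j≤n)
descendingCycle-zero zero    _   = refl
descendingCycle-zero (suc j) j<n =
  trans (cong (descendingCycle j (<⇒≤ j<n) ⟨$⟩ʳ_) (transpose-matchˡ zero _))
        (descendingCycle-fixes-above j (<⇒≤ j<n) _ (≤-reflexive (sym (toℕ-fromℕ< (s≤s j<n)))))

T-descendingCycle : (j : ℕ) .(j<n : j < n) →
  T (descendingCycle (suc j) j<n) ≈ descendingCycle j (<⇒≤ j<n)
T-descendingCycle j j<n i rewrite descendingCycle-zero (suc j) j<n =
  cong (descendingCycle j (<⇒≤ j<n) ⟨$⟩ʳ_) (transpose-involutive zero _ i)

iter-T-descendingCycle-moves-zero : (m j : ℕ) .(j≤n : j ≤ n) → m < j →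
  iter T m (descendingCycle j j≤n) ⟨$⟩ʳ zero ≢ zero
iter-T-descendingCycle-moves-zero zero j j≤n 0<j fixes =
  <-irrefl (trans (cong toℕ (trans (sym fixes) (descendingCycle-zero j j≤n)))
                  (toℕ-fromℕ< (s≤s j≤n))) 0<j
iter-T-descendingCycle-moves-zero (suc m) (suc j) j<n (s≤s m<j) fixes =
  iter-T-descendingCycle-moves-zero m j (<⇒≤ j<n) m<j
    (trans (sym (iter-T-cong m (T-descendingCycle j j<n) zero))
           (trans (cong (_⟨$⟩ʳ zero) (sym (iter-suc T m (descendingCycle (suc j) j<n)))) fixes))

terminates⇒n≤ : (m : ℕ) → Terminates (T {n}) m → n ≤ m
terminates⇒n≤ {n} m terminates = ≮⇒≥ λ m<n →
  iter-T-descendingCycle-moves-zero m n ≤-refl m<n (terminates (descendingCycle n ≤-refl))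

theorem1 : (k : ℕ) →
    ((w : Permutation′ (suc k)) → iter T k w ⟨$⟩ʳ zero ≡ zero)
    × IsTerminationNumber (T {k}) k
theorem1 k = iter-T-fixes-zero , iter-T-fixes-zero , terminates⇒n≤
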